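{- Let $\mathfrak S=\{S_1,\dots,S_n\}$, $n\ge1$, be a split system on a multiset $\mathcal M$, and let $G$ be a consistent thin subgraph of $\Gamma(\mathfrak S)$. Then for any two vertices $(A,S_i)$, $(B,S_j)$ of $G$ with $i\neq j$, $((A,S_i),(B,S_j))$ is an arc of $G$ if and only if there is a directed path in $G$ from $(A,S_i)$ to $(B,S_j)$ all of whose arcs are critical arcs of $G$.
   Context: A multiset $\mathcal M$ has underlying set $X$ with multiplicities $\mathcal M(x)\ge1$. Unions, inclusions and differences are in the multiset sense. A split of $\mathcal M$ is an unordered pair $\{A,B\}$, written $A|B$, of nonempty submultisets with multiset union $\mathcal M$; $\overline A=\mathcal M-A$. A split system on $\mathcal M$ is a finite multiset of splits. For $\mathfrak S=\{S_1,\dots,S_n\}$ (repetitions allowed), the split-containment graph $\Gamma(\mathfrak S)$ is the digraph with vertex multiset $\{(A,S_i):A\in S_i,\ 1\le i\le n\}$ and an arc from $(A,S_i)$ to $(B,S_j)$ whenever $i\neq j$ and $A\subsetneq B$. Let $D_1$ be the digraph on vertices $v,w,p,q$ with arcs $(v,p),(q,w)$. A subgraph $G$ of $\Gamma(\mathfrak S)$ is thin if $V(G)=V(\Gamma(\mathfrak S))$ and for all distinct $i,j$, with $S_i=A|\overline A$, $S_j=B|\overline B$, the subgraph of $G$ induced on $\{(A,S_i),(\overline A,S_i),(B,S_j),(\overline B,S_j)\}$ is isomorphic to $D_1$. An arc $((A,S_i),(B,S_j))$ of $G$ is critical if the only directed path in $G$ from $(A,S_i)$ to $(B,S_j)$ is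 that arc. $\mathcal C_G((A,S_i))$ is the set of vertices $(B,S_j)$ with $((B,S_j),(A,S_i))$ a critical arc of $G$. A thin subgraph $G$ is consistent if for every vertex $(A,S_i)$, $\bigcup_{(B,S_j)\in\mathcal C_G((A,S_i))}B\subseteq A$ (multiset union). -}

module Defs where

open import Data.Nat using (ℕ; _+_; _≤_; _<_)
open import Data.Fin using (Fin; zero; suc)
open import Data.Bool using (Bool; true; false)
open import Data.Product using (Σ; _×_; _,_; proj₁; ∃-syntax)
open import Data.Sum using (_⊎_)
open import Data.List using (List; []; _∷_)
open import Data.List.Relation.Unary.All using (All)
open import Data.List.Relation.Unary.Unique.Propositional using (Unique)
open import Relation.Nullary using (¬_)
open import Relation.Binary.PropositionalEquality using (_≡_)
open import Function.Bundles using (_↔_; _⇔_; Inverse)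

MSet : ℕ → Set
MSet m = Fin m → ℕ

_⊆ₘ_ : ∀ {m} → MSet m → MSet m → Set
A ⊆ₘ B = ∀ x → A x ≤ B x

_≈ₘ_ : ∀ {m} → MSet m → MSet m → Set
A ≈ₘ B = ∀ x → A x ≡ B x

_⊊ₘ_ : ∀ {m} → MSet m → MSet m → Set
A ⊊ₘ B = A ⊆ₘ B × ¬ (A ≈ₘ B)

-- multiset union (additive: A ∪ (M - A) = M)
_∪ₘ_ : ∀ {m} → MSet m → MSet m → MSet m
(A ∪ₘ B) x = A x + B x

∅ₘ : ∀ {m} → MSet m
∅ₘ x = 0

NonEmptyₘ : ∀ {m} → MSet m → Set
NonEmptyₘ A = ∃[ x ] (0 < A x)

-- a multiset with underlying set Fin m: every multiplicity ≥ 1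
IsMultiset : ∀ {m} → MSet m → Set
IsMultiset M = ∀ x → 1 ≤ M x

record Split {m : ℕ} (M : MSet m) : Set where
  field
    left      : MSet m
    right     : MSet m
    union     : (left ∪ₘ right) ≈ₘ M
    left-ne   : NonEmptyₘ left
    right-ne  : NonEmptyₘ right
open Split public

-- split system S₁ … Sₙ (repetitions allowed)
SplitSystem : ∀ {m} → MSet m → ℕ → Set
SplitSystem M n = Fin n → Split M

-- The split-containment graph. Vertex (i , true) = (left Sᵢ , Sᵢ),
-- (i , false) = (right Sᵢ , Sᵢ); so the vertex set is a multiset as in the paper.

Vertex : ℕ → Set
Vertex n = Fin n × Bool

side : ∀ {m n} {M : MSet m} → SplitSystem M n → Vertex n → MSet m
side S (i , true)  = left (S i)
side S (i , false) = right (S i)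

ΓArc : ∀ {m n} {M : MSet m} → SplitSystem M n → Vertex n → Vertex n → Set
ΓArc S (i , a) (j , b) = ¬ (i ≡ j) × (side S (i , a) ⊊ₘ side S (j , b))

-- a spanning subgraph G given by its (decidable) arc set
Graph : ℕ → Set
Graph n = Vertex n → Vertex n → Bool

Arc : ∀ {n} → Graph n → Vertex n → Vertex n → Set
Arc G u v = G u v ≡ true

IsSubgraph : ∀ {m n} {M : MSet m} → SplitSystem M n → Graph n → Set
IsSubgraph S G = ∀ u v → Arc G u v → ΓArc S u v

-- the digraph D₁ on v,w,p,q = 0,1,2,3 with arcs (v,p),(q,w)
D1Arc : Fin 4 → Fin 4 → Set
D1Arc a b = (a ≡ zero × b ≡ suc (suc zero)) ⊎ (a ≡ suc (suc (suc zero)) × b ≡ suc zero)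

-- the four vertices (A,Sᵢ),(Ā,Sᵢ),(B,Sⱼ),(B̄,Sⱼ), indexed by Bool × Bool
quad : ∀ {n} → Fin n → Fin n → Bool × Bool → Vertex n
quad i j (false , b) = (i , b)
quad i j (true  , b) = (j , b)

InducedIsoD1 : ∀ {n} → Graph n → Fin n → Fin n → Set
InducedIsoD1 G i j =
  Σ (Fin 4 ↔ (Bool × Bool)) λ φ →
    ∀ a b → D1Arc a b ⇔ Arc G (quad i j (Inverse.to φ a)) (quad i j (Inverse.to φ b))

IsThin : ∀ {m n} {M : MSet m} → SplitSystem M n → Graph n → Set
IsThin S G = IsSubgraph S G × (∀ i j → ¬ (i ≡ j) → InducedIsoD1 G i j)

-- directed paths (G is acyclic, being a subgraph of Γ, so walks are paths)

data Path {n} (G : Graph n) : Vertex n → Vertex n → Set where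
  [] : ∀ {u} → Path G u u
  _∷_ : ∀ {u w v} → Arc G u w → Path G w v → Path G u v

pathLength : ∀ {n} {G : Graph n} {u v} → Path G u v → ℕ
pathLength [] = 0
pathLength (_ ∷ p) = Data.Nat.suc (pathLength p)

Critical : ∀ {n} → Graph n → Vertex n → Vertex n → Set
Critical G u v = Arc G u v × (∀ (p : Path G u v) → pathLength p ≡ 1)

data CritPath {n} (G : Graph n) : Vertex n → Vertex n → Set where
  [] : ∀ {u} → CritPath G u u
  _∷_ : ∀ {u w v} → Critical G u w → CritPath G w v → CritPath G u v

⋃ₘ : ∀ {m} → List (MSet m) → MSet m
⋃ₘ [] = ∅ₘ
⋃ₘ (A ∷ As) = A ∪ₘ ⋃ₘ As

sides : ∀ {m n} {M : MSet m} → SplitSystem M n → List (Vertex n) → List (MSet m)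
sides S [] = []
sides S (w ∷ ws) = side S w ∷ sides S ws

-- consistency: the union of the sides of all vertices in C_G(u) is ⊆ side u.
-- C_G(u) is finite; we require it for every duplicate-free list of its elements,
-- which (all multiplicities being ≥ 0) is equivalent to the bound for the whole set.
IsConsistent : ∀ {m n} {M : MSet m} → SplitSystem M n → Graph n → Set
IsConsistent {n = n} S G =
  IsThin S G ×
  (∀ (u : Vertex n) (ws : List (Vertex n)) → Unique ws →
     All (λ w → Critical G w u) ws → ⋃ₘ (sides S ws) ⊆ₘ side S u)

-- Arcs of G strictly enlarge the side, so G is graded by the size of the side: every arc splits
-- into critical arcs by refining detours, which gives one direction. For the other, thinness
-- makes arcs come in opposite pairs (A ⊂ B gives B̄ ⊂ Ā), and consistency shows that two
-- incomparable vertices with a common descendant Y satisfy X ∪ X′ ⊆ Y. As A ∪ Ā = M, the two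
-- sides of a split never have a common descendant, and this rules out every configuration of
-- the induced D₁ on Sᵢ, Sⱼ except the arc (A, Sᵢ) → (B, Sⱼ) once (B, Sⱼ) is reachable from
-- (A, Sᵢ) by any path at all.
module Submission where

open import Defs
open import Data.Nat using (ℕ; zero; suc; _+_; _∸_; _≤_; _<_; z≤n)
open import Data.Nat.Properties
open import Data.Nat.Induction using (Acc; acc; <-wellFounded)
open import Data.Fin using (Fin; zero; suc)
import Data.Fin.Properties as Fin
open import Data.Bool using (Bool; true; false; not)
import Data.Bool.Properties as Bool
open import Data.Product using (_×_; _,_; proj₁; proj₂; ∃)
open import Data.Product.Properties using (≡-dec)
open import Data.Sum using (_⊎_; inj₁; inj₂; [_,_])
open import Data.Empty using (⊥; ⊥-elim)
open import Data.List using (List; []; _∷_)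
open import Data.List.Relation.Unary.All using (All; []; _∷_)
open import Data.List.Relation.Unary.AllPairs using ([]; _∷_)
open import Data.List.Relation.Unary.Unique.Propositional using (Unique)
open import Function using (_∘_)
open import Function.Bundles using (_⇔_; Inverse; Equivalence; mk⇔)
open import Relation.Binary.Definitions using (DecidableEquality)
open import Relation.Binary.PropositionalEquality using (_≡_; _≢_; refl; sym; trans; cong; subst; subst₂; ≢-sym)
open import Relation.Nullary using (¬_; Dec; yes; no; contradiction)
open import Relation.Nullary.Decidable using (map′; _⊎-dec_; _×-dec_)

size : ∀ {m} → MSet m → ℕ
size {zero}  A = 0
size {suc m} A = A zero + size (A ∘ suc)

size-mono : ∀ {m} (A B : MSet m) → A ⊆ₘ B → size A ≤ size B
size-mono {zero}  A B A⊆B = z≤n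
size-mono {suc m} A B A⊆B = +-mono-≤ (A⊆B zero) (size-mono (A ∘ suc) (B ∘ suc) (A⊆B ∘ suc))

size-mono-< : ∀ {m} (A B : MSet m) → A ⊆ₘ B → ∀ x → A x < B x → size A < size B
size-mono-< {suc m} A B A⊆B zero    Ax<Bx = +-mono-<-≤ Ax<Bx (size-mono (A ∘ suc) (B ∘ suc) (A⊆B ∘ suc))
size-mono-< {suc m} A B A⊆B (suc x) Ax<Bx = +-mono-≤-< (A⊆B zero) (size-mono-< (A ∘ suc) (B ∘ suc) (A⊆B ∘ suc) x Ax<Bx)

⊊ₘ⇒size< : ∀ {m} (A B : MSet m) → A ⊊ₘ B → size A < size B
⊊ₘ⇒size< {m} A B (A⊆B , A≉B) with Fin.¬∀⟶∃¬ m (λ x → A x ≡ B x) (λ x → A x ≟ B x) A≉B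
... | x , Ax≢Bx = size-mono-< A B A⊆B x (≤∧≢⇒< (A⊆B x) Ax≢Bx)

⊆ₘ-trans : ∀ {m} {A B C : MSet m} → A ⊆ₘ B → B ⊆ₘ C → A ⊆ₘ C
⊆ₘ-trans A⊆B B⊆C x = ≤-trans (A⊆B x) (B⊆C x)

∪ₘ-mono : ∀ {m} {A B C D : MSet m} → A ⊆ₘ C → B ⊆ₘ D → (A ∪ₘ B) ⊆ₘ (C ∪ₘ D)
∪ₘ-mono A⊆C B⊆D x = +-mono-≤ (A⊆C x) (B⊆D x)

≤-+-≡⇒≡ : ∀ {m n o p} → m ≤ o → n ≤ p → m + n ≡ o + p → m ≡ o
≤-+-≡⇒≡ {m} {n} {o} {p} m≤o n≤p m+n≡o+p =
  ≤-antisym m≤o (+-cancelʳ-≤ p o m (subst (_≤ m + p) m+n≡o+p (+-monoʳ-≤ m n≤p)))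

_≟ᵛ_ : ∀ {n} → DecidableEquality (Vertex n)
_≟ᵛ_ = ≡-dec Fin._≟_ Bool._≟_

any-vertex? : ∀ {n} {P : Vertex n → Set} → (∀ v → Dec (P v)) → Dec (∃ P)
any-vertex? P? =
  map′ (λ { (i , inj₁ p) → _ , p ; (i , inj₂ p) → _ , p })
       (λ { ((i , true) , p) → i , inj₁ p ; ((i , false) , p) → i , inj₂ p })
       (Fin.any? λ i → P? (i , true) ⊎-dec P? (i , false))

arc? : ∀ {n} (G : Graph n) u v → Dec (Arc G u v)
arc? G u v = G u v Bool.≟ true

module _ {n} {G : Graph n} where

  private variable u v w : Vertex n

  _∷ʳ_ : Path G u v → Arc G v w → Path G u w
  []      ∷ʳ e = e ∷ []
  (d ∷ p) ∷ʳ e = d ∷ (p ∷ʳ e)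

  unsnoc : Path G u v → u ≡ v ⊎ ∃ λ w → Path G u w × Arc G w v
  unsnoc [] = inj₁ refl
  unsnoc (e ∷ p) with unsnoc p
  ... | inj₁ refl          = inj₂ (_ , [] , e)
  ... | inj₂ (w , q , e′)  = inj₂ (w , e ∷ q , e′)

  _++ᶜ_ : CritPath G u v → CritPath G v w → CritPath G u w
  []      ++ᶜ q = q
  (c ∷ p) ++ᶜ q = c ∷ (p ++ᶜ q)

  critPath⇒path : CritPath G u v → Path G u v
  critPath⇒path []      = []
  critPath⇒path (c ∷ p) = proj₁ c ∷ critPath⇒path p

  critPath-unsnoc : CritPath G u v → u ≡ v ⊎ ∃ λ w → Path G u w × Critical G w v
  critPath-unsnoc [] = inj₁ refl
  critPath-unsnoc (c ∷ p) with critPath-unsnoc p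
  ... | inj₁ refl          = inj₂ (_ , [] , c)
  ... | inj₂ (w , q , c′)  = inj₂ (w , proj₁ c ∷ q , c′)

module Graded {n} (G : Graph n) (μ : Vertex n → ℕ) (μ-arc : ∀ {u v} → Arc G u v → μ u < μ v) where

  private variable u v : Vertex n

  μ-path : Path G u v → μ u ≤ μ v
  μ-path []      = ≤-refl
  μ-path (e ∷ p) = ≤-trans (<⇒≤ (μ-arc e)) (μ-path p)

  μ-path-≢ : Path G u v → u ≢ v → μ u < μ v
  μ-path-≢ []      u≢u = contradiction refl u≢u
  μ-path-≢ (e ∷ p) _   = <-≤-trans (μ-arc e) (μ-path p)

  path? : ∀ u v → Dec (Path G u v)
  path? u v = path-acc? u v (<-wellFounded (μ v))
    where
    path-acc? : ∀ x y → Acc _<_ (μ y) → Dec (Path G x y)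
    path-acc? x y (acc rs) =
      map′ [ (λ { refl → [] }) , (λ (w , p , e) → p ∷ʳ e) ] unsnoc ((x ≟ᵛ y) ⊎-dec any-vertex? last?)
      where
      last? : ∀ w → Dec (Path G x w × Arc G w y)
      last? w with arc? G w y
      ... | yes e = map′ (_, e) proj₁ (path-acc? x w (rs (μ-arc e)))
      ... | no ¬e = no (¬e ∘ proj₂)

  Detour : Vertex n → Vertex n → Set
  Detour u v = ∃ λ w → Arc G u w × ∃ λ w′ → Arc G w w′ × Path G w′ v

  detour? : ∀ u v → Dec (Detour u v)
  detour? u v = any-vertex? λ w → arc? G u w ×-dec any-vertex? λ w′ → arc? G w w′ ×-dec path? w′ v

  ¬detour⇒critical : Arc G u v → ¬ Detour u v → Critical G u v
  ¬detour⇒critical e ¬d = e , only-path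
    where
    only-path : ∀ p → pathLength p ≡ 1
    only-path []             = contradiction (μ-arc e) (<-irrefl refl)
    only-path (_ ∷ [])       = refl
    only-path (e₁ ∷ e₂ ∷ p)  = contradiction (_ , e₁ , _ , e₂ , p) ¬d

  -- Recursion on the gap μ v ∸ μ u, which is larger than the gap of every arc of a detour.
  arc⇒critPath : Arc G u v → CritPath G u v
  arc⇒critPath e = go (<-wellFounded _) e
    where
    go : ∀ {u v} → Acc _<_ (μ v ∸ μ u) → Arc G u v → CritPath G u v
    go {u} {v} (acc rs) e with detour? u v
    ... | no ¬d = ¬detour⇒critical e ¬d ∷ []
    ... | yes (w , e₁ , w′ , e₂ , p) =
      go (rs (∸-monoˡ-< (<-≤-trans (μ-arc e₂) (μ-path p)) (<⇒≤ (μ-arc e₁)))) e₁ ++ᶜ along (e₂ ∷ p) (μ-arc e₁)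
      where
      along : ∀ {x} → Path G x v → μ u < μ x → CritPath G x v
      along []              _     = []
      along {x} (d ∷ q) μu<μx =
        go (rs (≤-<-trans (∸-monoˡ-≤ (μ x) (μ-path q)) (∸-monoʳ-< μu<μx (μ-path (d ∷ q))))) d
          ++ᶜ along q (<-trans μu<μx (μ-arc d))

  path⇒critPath : Path G u v → CritPath G u v
  path⇒critPath []      = []
  path⇒critPath (e ∷ p) = arc⇒critPath e ++ᶜ path⇒critPath p

  last-critical : Path G u v → u ≡ v ⊎ ∃ λ w → Path G u w × Critical G w v
  last-critical = critPath-unsnoc ∘ path⇒critPath

D1-out-unique : ∀ {a b b′} → D1Arc a b → D1Arc a b′ → b ≡ b′
D1-out-unique (inj₁ (refl , refl)) (inj₁ (_ , refl)) = refl
D1-out-unique (inj₁ (refl , refl)) (inj₂ (() , _))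
D1-out-unique (inj₂ (refl , refl)) (inj₁ (() , _))
D1-out-unique (inj₂ (refl , refl)) (inj₂ (_ , refl)) = refl

D1-target-not-source : ∀ {a b c} → D1Arc a b → D1Arc c a → ⊥
D1-target-not-source (inj₁ (refl , refl)) (inj₁ (_ , ()))
D1-target-not-source (inj₁ (refl , refl)) (inj₂ (_ , ()))
D1-target-not-source (inj₂ (refl , refl)) (inj₁ (_ , ()))
D1-target-not-source (inj₂ (refl , refl)) (inj₂ (_ , ()))

D1-incident : ∀ a → ∃ λ b → D1Arc a b ⊎ D1Arc b a
D1-incident zero                   = _ , inj₁ (inj₁ (refl , refl))
D1-incident (suc zero)             = _ , inj₂ (inj₂ (refl , refl))
D1-incident (suc (suc zero))       = _ , inj₂ (inj₁ (refl , refl))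
D1-incident (suc (suc (suc zero))) = _ , inj₁ (inj₂ (refl , refl))

module InducedD1 {n} {G : Graph n} {i j : Fin n} (iso : InducedIsoD1 G i j) where

  open Inverse (proj₁ iso)

  Arcᵠ : Bool × Bool → Bool × Bool → Set
  Arcᵠ c d = Arc G (quad i j c) (quad i j d)

  private variable c d d′ : Bool × Bool

  arc⇒D1 : Arcᵠ c d → D1Arc (from c) (from d)
  arc⇒D1 {c} {d} e = Equivalence.from (proj₂ iso (from c) (from d))
    (subst₂ Arcᵠ (sym (strictlyInverseˡ c)) (sym (strictlyInverseˡ d)) e)

  from-injective : from c ≡ from d → c ≡ d
  from-injective {c} {d} eq = trans (sym (strictlyInverseˡ c)) (trans (cong to eq) (strictlyInverseˡ d))

  out-unique : Arcᵠ c d → Arcᵠ c d′ → d ≡ d′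
  out-unique e e′ = from-injective (D1-out-unique (arc⇒D1 e) (arc⇒D1 e′))

  target-not-source : Arcᵠ c d → Arcᵠ d′ c → ⊥
  target-not-source e e′ = D1-target-not-source (arc⇒D1 e) (arc⇒D1 e′)

  incident : ∀ c → ∃ λ d → Arcᵠ c d ⊎ Arcᵠ d c
  incident c with D1-incident (from c)
  ... | a , inj₁ x = to a , inj₁ (subst (λ c′ → Arcᵠ c′ (to a)) (strictlyInverseˡ c) (to-D1 x))
    where to-D1 = Equivalence.to (proj₂ iso (from c) a)
  ... | a , inj₂ x = to a , inj₂ (subst (Arcᵠ (to a)) (strictlyInverseˡ c) (to-D1 x))
    where to-D1 = Equivalence.to (proj₂ iso a (from c))

module _ {m n} {M : MSet m} (S : SplitSystem M n) where

  private variable i j : Fin n ; a b b′ : Bool ; u v x x′ y z z′ : Vertex n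

  opposite : Vertex n → Vertex n
  opposite (i , a) = i , not a

  opposite-≢ : ∀ v → v ≢ opposite v
  opposite-≢ (i , a) = Bool.not-¬ refl ∘ cong proj₂

  side-opposite : ∀ v x → side S v x + side S (opposite v) x ≡ M x
  side-opposite (i , true)  x = union (S i) x
  side-opposite (i , false) x = trans (+-comm (right (S i) x) _) (union (S i) x)

  side-nonempty : ∀ v → NonEmptyₘ (side S v)
  side-nonempty (i , true)  = left-ne (S i)
  side-nonempty (i , false) = right-ne (S i)

  side∪opposite⊈side : ∀ u v → ¬ ((side S u ∪ₘ side S (opposite u)) ⊆ₘ side S v)
  side∪opposite⊈side u v u∪ū⊆v with side-nonempty (opposite v)
  ... | x , 0<v̄x = <⇒≱ v<u∪ū (u∪ū⊆v x)
    where
    open ≤-Reasoning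
    v<u∪ū : side S v x < side S u x + side S (opposite u) x
    v<u∪ū = begin-strict
      side S v x                              <⟨ m<m+n _ 0<v̄x ⟩
      side S v x + side S (opposite v) x      ≡⟨ side-opposite v x ⟩
      M x                                     ≡⟨ side-opposite u x ⟨
      side S u x + side S (opposite u) x      ∎

  module Thin (G : Graph n) (thin : IsThin S G) where

    arc⇒⊊ₘ : Arc G u v → side S u ⊊ₘ side S v
    arc⇒⊊ₘ {_ , _} {_ , _} e = proj₂ (proj₁ thin _ _ e)

    arc⇒⊆ₘ : Arc G u v → side S u ⊆ₘ side S v
    arc⇒⊆ₘ = proj₁ ∘ arc⇒⊊ₘ

    arc⇒index≢ : Arc G (i , a) (j , b) → i ≢ j
    arc⇒index≢ e = proj₁ (proj₁ thin _ _ e)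

    path⇒⊆ₘ : Path G u v → side S u ⊆ₘ side S v
    path⇒⊆ₘ []      = λ _ → ≤-refl
    path⇒⊆ₘ (e ∷ p) = ⊆ₘ-trans (arc⇒⊆ₘ e) (path⇒⊆ₘ p)

    μ : Vertex n → ℕ
    μ = size ∘ side S

    μ-arc : Arc G u v → μ u < μ v
    μ-arc e = ⊊ₘ⇒size< _ _ (arc⇒⊊ₘ e)

    open Graded G μ μ-arc

    module Induced (i j : Fin n) (i≢j : i ≢ j) = InducedD1 {G = G} {i} {j} (proj₂ thin i j i≢j)

    out-unique : Arc G (i , a) (j , b) → Arc G (i , a) (j , b′) → b ≡ b′
    out-unique {i} {a} {j} {b} {b′} e e′ =
      cong proj₂ (Induced.out-unique i j (arc⇒index≢ e) {c = false , a} {d = true , b} {d′ = true , b′} e e′)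

    target-not-source : Arc G (i , a) (j , b) → Arc G (j , b′) (i , a) → ⊥
    target-not-source {i} {a} {j} {b} {b′} e e′ =
      Induced.target-not-source i j (arc⇒index≢ e) {c = false , a} {d = true , b} {d′ = true , b′} e e′

    incident : i ≢ j → ∀ a → ∃ λ b → Arc G (i , a) (j , b) ⊎ Arc G (j , b) (i , a)
    incident {i} {j} i≢j a with Induced.incident i j i≢j (false , a)
    ... | (false , _) , inj₁ e = contradiction refl (arc⇒index≢ e)
    ... | (false , _) , inj₂ e = contradiction refl (arc⇒index≢ e)
    ... | (true  , b) , inj₁ e = b , inj₁ e
    ... | (true  , b) , inj₂ e = b , inj₂ e

    -- Both sides of an index sum to M, so containments between both pairs of opposite sides are equalities.
    no-opposite-parallel-arcs : Arc G (i , a) (j , b) → Arc G (i , not a) (j , not b) → ⊥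
    no-opposite-parallel-arcs {i} {a} {j} {b} e e′ = proj₂ (arc⇒⊊ₘ e) λ x →
      ≤-+-≡⇒≡ (arc⇒⊆ₘ e x) (arc⇒⊆ₘ e′ x) (trans (side-opposite (i , a) x) (sym (side-opposite (j , b) x)))

    arc-opposite : Arc G u v → Arc G (opposite v) (opposite u)
    arc-opposite {i , a} {j , b} e with incident (≢-sym (arc⇒index≢ e)) (not b)
    ... | a′ , inj₁ e′ with a′ Bool.≟ a
    ...   | yes refl = ⊥-elim (target-not-source e e′)
    ...   | no a′≢a  = subst (λ c → Arc G (j , not b) (i , c)) (Bool.¬-not a′≢a) e′
    arc-opposite {i , a} {j , b} e | a′ , inj₂ e′ with a′ Bool.≟ a
    ...   | yes refl = ⊥-elim (Bool.not-¬ refl (out-unique e e′))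
    ...   | no a′≢a  = ⊥-elim (no-opposite-parallel-arcs e (subst (λ c → Arc G (i , c) (j , not b)) (Bool.¬-not a′≢a) e′))

    path-opposite : Path G u v → Path G (opposite v) (opposite u)
    path-opposite []      = []
    path-opposite (e ∷ p) = path-opposite p ∷ʳ arc-opposite e

    module Consistent
      (consistent : ∀ (u : Vertex n) (ws : List (Vertex n)) → Unique ws →
                      All (λ w → Critical G w u) ws → ⋃ₘ (sides S ws) ⊆ₘ side S u) where

      critical-pair-∪ₘ⊆ₘ : z ≢ z′ → Critical G z y → Critical G z′ y → (side S z ∪ₘ side S z′) ⊆ₘ side S y
      critical-pair-∪ₘ⊆ₘ {z} {z′} {y} z≢z′ c c′ x =
        subst (_≤ side S y x) (cong (side S z x +_) (+-identityʳ _))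
          (consistent y (z ∷ z′ ∷ []) ((z≢z′ ∷ []) ∷ [] ∷ []) (c ∷ c′ ∷ []) x)

      -- Follow the last critical arcs into y back until they come from distinct vertices.
      incomparable-ancestors-∪ₘ⊆ₘ : Path G x y → Path G x′ y → ¬ Path G x x′ → ¬ Path G x′ x →
                                   (side S x ∪ₘ side S x′) ⊆ₘ side S y
      incomparable-ancestors-∪ₘ⊆ₘ = go (<-wellFounded _)
        where
        go : ∀ {x x′ y} → Acc _<_ (μ y) → Path G x y → Path G x′ y → ¬ Path G x x′ → ¬ Path G x′ x →
             (side S x ∪ₘ side S x′) ⊆ₘ side S y
        go (acc rs) p p′ ¬xx′ ¬x′x with last-critical p | last-critical p′
        ... | inj₁ refl | _         = contradiction p′ ¬x′x
        ... | inj₂ _    | inj₁ refl = contradiction p ¬xx′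
        ... | inj₂ (z , q , c) | inj₂ (z′ , q′ , c′) with z ≟ᵛ z′
        ...   | yes refl = ⊆ₘ-trans (go (rs (μ-arc (proj₁ c))) q q′ ¬xx′ ¬x′x) (arc⇒⊆ₘ (proj₁ c))
        ...   | no z≢z′  = ⊆ₘ-trans (∪ₘ-mono (path⇒⊆ₘ q) (path⇒⊆ₘ q′)) (critical-pair-∪ₘ⊆ₘ z≢z′ c c′)

      -- The first arc (i , a) → (j , b) has the opposite arc (j , not b) → (i , not a), so both sides
      -- of j reach (i , not a); by induction on μ (i , not a) they are incomparable.
      no-path-to-opposite : ∀ v → ¬ Path G v (opposite v)
      no-path-to-opposite v = go (<-wellFounded _) refl
        where
        go : ∀ {u v} → Acc _<_ (μ v) → v ≡ opposite u → ¬ Path G u v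
        go _ u≡ū [] = opposite-≢ _ u≡ū
        go {i , a} (acc rs) refl (_∷_ {w = j , b} e p) =
          side∪opposite⊈side (j , b) (i , not a)
            (incomparable-ancestors-∪ₘ⊆ₘ p (arc-opposite e ∷ []) ¬b⇝b̄ ¬b̄⇝b)
          where
          ¬b⇝b̄ : ¬ Path G (j , b) (j , not b)
          ¬b⇝b̄ = go (rs (μ-arc (arc-opposite e))) refl
          ¬b̄⇝b : ¬ Path G (j , not b) (j , b)
          ¬b̄⇝b = go (rs (μ-path-≢ p (arc⇒index≢ e ∘ sym ∘ cong proj₁)))
                    (cong (j ,_) (sym (Bool.not-involutive b)))

      no-path-from-opposite : ∀ v → ¬ Path G (opposite v) v
      no-path-from-opposite (i , a) =
        subst (λ c → ¬ Path G (i , not a) (i , c)) (Bool.not-involutive a) (no-path-to-opposite (i , not a))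

      opposites-no-common-descendant : Path G v y → Path G (opposite v) y → ⊥
      opposites-no-common-descendant {v} {y} p p̄ =
        side∪opposite⊈side v y
          (incomparable-ancestors-∪ₘ⊆ₘ p p̄ (no-path-to-opposite v) (no-path-from-opposite v))

      -- (i , a) is joined to exactly one side of j; any choice but (i , a) → (j , b)
      -- gives a cycle or a common descendant of opposite sides.
      path⇒arc : i ≢ j → Path G (i , a) (j , b) → Arc G (i , a) (j , b)
      path⇒arc {i} {j} {a} {b} i≢j p with incident i≢j a
      ... | b′ , inj₁ e with b′ Bool.≟ b
      ...   | yes refl = e
      ...   | no b′≢b with Bool.¬-not (≢-sym b′≢b)
      ...     | refl = ⊥-elim (opposites-no-common-descendant (arc-opposite e ∷ []) (path-opposite p))
      path⇒arc {i} {j} {a} {b} i≢j p | b′ , inj₂ e with b′ Bool.≟ b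
      ...   | yes refl = ⊥-elim (<⇒≱ (μ-arc e) (μ-path p))
      ...   | no b′≢b with Bool.¬-not (≢-sym b′≢b)
      ...     | refl = ⊥-elim (opposites-no-common-descendant p (arc-opposite e ∷ []))

lemma2 : (m n : ℕ) (M : MSet m) → IsMultiset M → 1 ≤ n →
    (S : SplitSystem M n) (G : Graph n) → IsConsistent S G →
    (i j : Fin n) (a b : Bool) → ¬ (i ≡ j) →
    Arc G (i , a) (j , b) ⇔ CritPath G (i , a) (j , b)
lemma2 m n M _ _ S G (thin , consistent) i j a b i≢j =
  mk⇔ arc⇒critPath (path⇒arc i≢j ∘ critPath⇒path)
  where
  open Thin S G thin
  open Graded G μ μ-arc
  open Consistent consistent
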